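{- Let $w,x,u$ be maximal $\mathsf{ILP_0}$-consistent sets and $S$ a set of formulas. If $w\prec x$ and $x\prec_S u$, then $w\prec_{x^\Box_S}u$.
   Context: Modal formulas are built from propositional variables, $\bot$, $\to$ and binary $\rhd$; $\Box A$ abbreviates $\neg A\rhd\bot$, $\Diamond A$ abbreviates $\neg\Box\neg A$. $\mathsf{IL}$ has as axioms all instances of classical tautologies and of: $\Box(A\to B)\to(\Box A\to\Box B)$; $\Box(\Box A\to A)\to\Box A$; $\Box(A\to B)\to A\rhd B$; $(A\rhd B)\wedge(B\rhd C)\to A\rhd C$; $(A\rhd C)\wedge(B\rhd C)\to A\vee B\rhd C$; $A\rhd B\to(\Diamond A\to\Diamond B)$; $\Diamond A\rhd A$; rules modus ponens and necessitation. $\mathsf{ILP_0}$ is $\mathsf{IL}$ plus all instances of $A\rhd\Diamond B\to\Box(A\rhd B)$. For maximal consistent sets $w,u$ and a set of formulas $S$: $w\prec_S u$ iff for every finite $S'\subseteq S$ and every formula $A$, $A\rhd\bigvee_{G\in S'}\neg G\in w$ implies $\neg A\in u$ and $\Box\neg A\in u$ (empty disjunction is $\bot$); $w\prec u$ means $w\prec_\emptyset u$. For a maximal consistent set $x$, $x^\Box_S=\{\Box\neg A : A\rhd\bigvee_{G\in S'}\neg G\in x \text{ for some finite } S'\subseteq S\}$. -}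

module Defs where

open import Data.Nat using (ℕ)
open import Data.Bool using (Bool; true; false; not; _∨_)
open import Data.List using (List; []; _∷_; foldr; map)
open import Data.List.Relation.Unary.All using (All)
open import Data.Product using (Σ; _×_; ∃)
open import Relation.Binary.PropositionalEquality using (_≡_)
open import Relation.Nullary using (¬_)

infixr 6 _⇒_
infix 7 _▷_

data Fm : Set where
  var : ℕ → Fm
  ⊥'  : Fm
  _⇒_ : Fm → Fm → Fm
  _▷_ : Fm → Fm → Fm

~_ : Fm → Fm
~ A = A ⇒ ⊥'

⊤' : Fm
⊤' = ⊥' ⇒ ⊥'

_∨'_ : Fm → Fm → Fm
A ∨' B = (~ A) ⇒ B

_∧'_ : Fm → Fm → Fm
A ∧' B = ~ (A ⇒ ~ B)

□ : Fm → Fm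
□ A = (~ A) ▷ ⊥'

◇ : Fm → Fm
◇ A = ~ □ (~ A)

-- Classical (propositional) evaluation: variables and ▷-formulas are atoms.
eval : (Fm → Bool) → Fm → Bool
eval v (var p) = v (var p)
eval v ⊥' = false
eval v (A ⇒ B) = not (eval v A) ∨ eval v B
eval v (A ▷ B) = v (A ▷ B)

Taut : Fm → Set
Taut A = (v : Fm → Bool) → eval v A ≡ true

data ⊢ILP₀ : Fm → Set where
  taut : ∀ {A} → Taut A → ⊢ILP₀ A
  K    : ∀ A B → ⊢ILP₀ (□ (A ⇒ B) ⇒ (□ A ⇒ □ B))
  L    : ∀ A → ⊢ILP₀ (□ (□ A ⇒ A) ⇒ □ A)
  J1   : ∀ A B → ⊢ILP₀ (□ (A ⇒ B) ⇒ A ▷ B)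
  J2   : ∀ A B C → ⊢ILP₀ ((A ▷ B) ∧' (B ▷ C) ⇒ A ▷ C)
  J3   : ∀ A B C → ⊢ILP₀ ((A ▷ C) ∧' (B ▷ C) ⇒ (A ∨' B) ▷ C)
  J4   : ∀ A B → ⊢ILP₀ (A ▷ B ⇒ (◇ A ⇒ ◇ B))
  J5   : ∀ A → ⊢ILP₀ (◇ A ▷ A)
  P0   : ∀ A B → ⊢ILP₀ (A ▷ ◇ B ⇒ □ (A ▷ B))
  mp   : ∀ {A B} → ⊢ILP₀ (A ⇒ B) → ⊢ILP₀ A → ⊢ILP₀ B
  nec  : ∀ {A} → ⊢ILP₀ A → ⊢ILP₀ (□ A)

FmSet : Set₁
FmSet = Fm → Set

⋀ : List Fm → Fm
⋀ = foldr _∧'_ ⊤'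

⋁¬ : List Fm → Fm
⋁¬ S' = foldr _∨'_ ⊥' (map ~_ S')

_⊆fin_ : List Fm → FmSet → Set
Γ ⊆fin X = All X Γ

Consistent : FmSet → Set
Consistent X = ¬ (Σ (List Fm) λ Γ → Γ ⊆fin X × ⊢ILP₀ (⋀ Γ ⇒ ⊥'))

_∪｛_｝ : FmSet → Fm → FmSet
(X ∪｛ A ｝) B = X B ⊎' (B ≡ A)
  where
  open import Data.Sum using () renaming (_⊎_ to _⊎'_)

MCS : FmSet → Set
MCS X = Consistent X × (∀ A → Consistent (X ∪｛ A ｝) → X A)

_≺[_]_ : FmSet → FmSet → FmSet → Set
w ≺[ S ] u = (S' : List Fm) → S' ⊆fin S → (A : Fm) →
             w (A ▷ ⋁¬ S') → u (~ A) × u (□ (~ A))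

∅ : FmSet
∅ _ = ⊥
  where open import Data.Empty using (⊥)

_≺_ : FmSet → FmSet → Set
w ≺ u = w ≺[ ∅ ] u

boxSet : FmSet → FmSet → FmSet
boxSet x S B = Σ Fm λ A → Σ (List Fm) λ S' →
  S' ⊆fin S × x (A ▷ ⋁¬ S') × (B ≡ □ (~ A))

module Submission where

-- Let S' ⊆ x^□_S be finite, so S' = □¬A₁, …, □¬Aₙ with
-- Aᵢ ▷ ⋁¬Sᵢ ∈ x and Sᵢ ⊆ S finite.  Since ¬□¬Aᵢ is ◇Aᵢ, the formula ⋁¬S'
-- implies ◇(A₁ ∨ … ∨ Aₙ), while J3 (with J1/J2) gives
-- (A₁ ∨ … ∨ Aₙ) ▷ ⋁¬(S₁ ++ … ++ Sₙ) ∈ x.  Now if A ▷ ⋁¬S' ∈ w, then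
-- A ▷ ◇(⋁ Aᵢ) ∈ w, so by P₀ □(A ▷ ⋁ Aᵢ) ∈ w; as w ≺ x this gives
-- A ▷ ⋁ Aᵢ ∈ x, hence A ▷ ⋁¬(S₁ ++ … ++ Sₙ) ∈ x, and x ≺_S u yields
-- ¬A, □¬A ∈ u.

open import Defs
open import Data.Bool using (Bool; true; false; not; _∨_)
open import Data.List using (List; []; _∷_; foldr; _++_)
open import Data.List.Relation.Unary.All using (All; []; _∷_)
open import Data.List.Relation.Unary.All.Properties using (++⁺; ++⁻ˡ; ++⁻ʳ)
open import Data.Product using (Σ; _×_; _,_; proj₁; proj₂)
open import Data.Sum using (inj₁; inj₂)
open import Relation.Binary.PropositionalEquality using (_≡_; refl; subst)

-- Truth of a formula under a classical valuation, wrapped in a record so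
-- that the formula stays visible to type inference.
record Holds (v : Fm → Bool) (A : Fm) : Set where
  constructor holds
  field truth : eval v A ≡ true
open Holds

module Classical {v : Fm → Bool} where

  ⇒-elim : ∀ {P Q} → Holds v (P ⇒ Q) → Holds v P → Holds v Q
  ⇒-elim {Q = Q} (holds h) (holds p) =
    holds (subst (λ b → not b ∨ eval v Q ≡ true) p h)

  ⇒-intro : ∀ {P Q} → (Holds v P → Holds v Q) → Holds v (P ⇒ Q)
  ⇒-intro {P} {Q} f = holds (truth′ f)
    where
    truth′ : (Holds v P → Holds v Q) → eval v (P ⇒ Q) ≡ true
    truth′ f with eval v P in e
    ... | false = refl
    ... | true  = truth (f (holds e))

  ⊥-elim′ : ∀ {R} → Holds v ⊥' → Holds v R
  ⊥-elim′ (holds ())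

  by-cases : ∀ P {R : Set} → (Holds v P → R) → (Holds v (~ P) → R) → R
  by-cases P f g with eval v P in e
  ... | true  = f (holds e)
  ... | false = g (⇒-intro λ p → holds (subst (_≡ true) e (truth p)))

  ¬¬-elim : ∀ {P} → Holds v (~ (~ P)) → Holds v P
  ¬¬-elim {P} h = by-cases P (λ p → p) (λ np → ⊥-elim′ (⇒-elim h np))

  ∨-introˡ : ∀ {P Q} → Holds v P → Holds v (P ∨' Q)
  ∨-introˡ p = ⇒-intro λ np → ⊥-elim′ (⇒-elim np p)

  ∨-introʳ : ∀ {P Q} → Holds v Q → Holds v (P ∨' Q)
  ∨-introʳ q = ⇒-intro λ _ → q

  ∨-elim : ∀ {P Q R} → Holds v (P ∨' Q) →
           (Holds v P → Holds v R) → (Holds v Q → Holds v R) → Holds v R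
  ∨-elim {P} h f g = by-cases P f (λ np → g (⇒-elim h np))

  ∧-intro : ∀ {P Q} → Holds v P → Holds v Q → Holds v (P ∧' Q)
  ∧-intro p q = ⇒-intro λ h → ⇒-elim (⇒-elim h p) q

  ∧-elimˡ : ∀ {P Q} → Holds v (P ∧' Q) → Holds v P
  ∧-elimˡ {P} h =
    by-cases P (λ p → p) (λ np → ⊥-elim′ (⇒-elim h (⇒-intro λ p → ⊥-elim′ (⇒-elim np p))))

  ∧-elimʳ : ∀ {P Q} → Holds v (P ∧' Q) → Holds v Q
  ∧-elimʳ {Q = Q} h = by-cases Q (λ q → q) (λ nq → ⊥-elim′ (⇒-elim h (⇒-intro λ _ → nq)))

  ⋀-intro : ∀ Γ → All (Holds v) Γ → Holds v (⋀ Γ)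
  ⋀-intro []      []       = holds refl
  ⋀-intro (_ ∷ Γ) (p ∷ ps) = ∧-intro p (⋀-intro Γ ps)

  ⋀-elim : ∀ Γ → Holds v (⋀ Γ) → All (Holds v) Γ
  ⋀-elim []      _ = []
  ⋀-elim (g ∷ Γ) h = ∧-elimˡ h ∷ ⋀-elim Γ (∧-elimʳ {P = g} h)

  ⋁¬-++ˡ : ∀ a b → Holds v (⋁¬ a) → Holds v (⋁¬ (a ++ b))
  ⋁¬-++ˡ []      b h = ⊥-elim′ h
  ⋁¬-++ˡ (_ ∷ a) b h = ∨-elim h ∨-introˡ (λ r → ∨-introʳ (⋁¬-++ˡ a b r))

  ⋁¬-++ʳ : ∀ a b → Holds v (⋁¬ b) → Holds v (⋁¬ (a ++ b))
  ⋁¬-++ʳ []      b h = h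
  ⋁¬-++ʳ (_ ∷ a) b h = ∨-introʳ (⋁¬-++ʳ a b h)

open Classical

⊢-taut : ∀ {A} → (∀ v → Holds v A) → ⊢ILP₀ A
⊢-taut f = taut λ v → truth (f v)

⊢-⋀ : ∀ Γ → All ⊢ILP₀ Γ → ⊢ILP₀ (⋀ Γ)
⊢-⋀ []      []       = ⊢-taut λ _ → holds refl
⊢-⋀ (_ ∷ Γ) (d ∷ ds) = mp (mp (⊢-taut λ _ → ⇒-intro λ p → ⇒-intro λ q → ∧-intro p q) d) (⊢-⋀ Γ ds)

⊢-from : ∀ Γ {C} → All ⊢ILP₀ Γ → (∀ v → All (Holds v) Γ → Holds v C) → ⊢ILP₀ C
⊢-from Γ ds f = mp (⊢-taut λ v → ⇒-intro λ h → f v (⋀-elim Γ h)) (⊢-⋀ Γ ds)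

◇-mono : ∀ {A B} → ⊢ILP₀ (A ⇒ B) → ⊢ILP₀ (◇ A ⇒ ◇ B)
◇-mono {A} {B} d = ⊢-from (_ ∷ []) (□-contra ∷ [])
    λ { v (p ∷ []) → ⇒-intro λ na → ⇒-intro λ b → ⇒-elim na (⇒-elim p b) }
  where
  □-contra : ⊢ILP₀ (□ (~ B) ⇒ □ (~ A))
  □-contra = mp (K (~ B) (~ A)) (nec (⊢-from (_ ∷ []) (d ∷ [])
    λ { v (p ∷ []) → ⇒-intro λ nb → ⇒-intro λ a → ⇒-elim nb (⇒-elim p a) }))

drop-extension : ∀ {X : FmSet} {B} (Δ : List Fm) → All (X ∪｛ B ｝) Δ →
  Σ (List Fm) λ Δ′ → All X Δ′ × (∀ v → Holds v B → All (Holds v) Δ′ → All (Holds v) Δ)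
drop-extension [] [] = [] , [] , λ _ _ _ → []
drop-extension (d ∷ Δ) (p ∷ ps) with drop-extension Δ ps
drop-extension (d ∷ Δ) (inj₁ x ∷ ps)    | Δ′ , sub , back =
  d ∷ Δ′ , x ∷ sub , λ { v b (t ∷ ts) → t ∷ back v b ts }
drop-extension (d ∷ Δ) (inj₂ refl ∷ ps) | Δ′ , sub , back =
  Δ′ , sub , λ v b ts → b ∷ back v b ts

module MaximalConsistent {X : FmSet} (mX : MCS X) where

  -- X contains every derivable consequence of finitely many of its members:
  -- otherwise X ∪ {B} would be inconsistent, which makes X inconsistent.
  closed : ∀ {B} Γ → All X Γ → ⊢ILP₀ (⋀ Γ ⇒ B) → X B
  closed {B} Γ inX d = proj₂ mX B λ { (Δ , ps , refute) →
    let Δ′ , inX′ , back = drop-extension Δ ps in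
    proj₁ mX (Γ ++ Δ′ , ++⁺ inX inX′ ,
      ⊢-from (_ ∷ _ ∷ []) (d ∷ refute ∷ []) λ { v (γ⇒B ∷ Δ⇒⊥ ∷ []) → ⇒-intro λ h →
        let hs = ⋀-elim (Γ ++ Δ′) h
            b  = ⇒-elim γ⇒B (⋀-intro Γ (++⁻ˡ Γ hs))
        in ⇒-elim Δ⇒⊥ (⋀-intro Δ (back v b (++⁻ʳ Γ hs))) }) }

  closed-sem : ∀ {B} Γ → All X Γ → (∀ v → All (Holds v) Γ → Holds v B) → X B
  closed-sem Γ inX f = closed Γ inX (⊢-taut λ v → ⇒-intro λ h → f v (⋀-elim Γ h))

  theorem : ∀ {B} → ⊢ILP₀ B → X B
  theorem d = closed [] [] (⊢-from (_ ∷ []) (d ∷ []) λ { v (p ∷ []) → ⇒-intro λ _ → p })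

  ▷-trans : ∀ {C D E} → X (C ▷ D) → X (D ▷ E) → X (C ▷ E)
  ▷-trans {C} {D} {E} h h′ = closed-sem (_ ∷ _ ∷ _ ∷ []) (h ∷ h′ ∷ theorem (J2 C D E) ∷ [])
    λ { v (p ∷ q ∷ j2 ∷ []) → ⇒-elim j2 (∧-intro p q) }

  ▷-weakenʳ : ∀ {C D E} → X (C ▷ D) → ⊢ILP₀ (D ⇒ E) → X (C ▷ E)
  ▷-weakenʳ {D = D} {E} h d = ▷-trans h (theorem (mp (J1 D E) (nec d)))

  ▷-join : ∀ {C D E} → X (C ▷ E) → X (D ▷ E) → X ((C ∨' D) ▷ E)
  ▷-join {C} {D} {E} h h′ = closed-sem (_ ∷ _ ∷ _ ∷ []) (h ∷ h′ ∷ theorem (J3 C D E) ∷ [])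
    λ { v (p ∷ q ∷ j3 ∷ []) → ⇒-elim j3 (∧-intro p q) }

open MaximalConsistent

⋁ : List Fm → Fm
⋁ = foldr _∨'_ ⊥'

-- A finite S' ⊆ x^□_S, S' = {□¬A₁, …, □¬Aₙ}, is summarised by the list
-- As = A₁, …, Aₙ and a finite Sᵤ ⊆ S such that ⋁As ▷ ⋁¬Sᵤ ∈ x and
-- ⋁¬S' (= ⋁ ◇Aᵢ) provably implies ◇⋁As.
boxSet-collect : ∀ {x S} → MCS x → (S' : List Fm) → All (boxSet x S) S' →
  Σ (List Fm) λ As → Σ (List Fm) λ Sᵤ →
    All S Sᵤ × x (⋁ As ▷ ⋁¬ Sᵤ) × ⊢ILP₀ (⋁¬ S' ⇒ ◇ (⋁ As))
boxSet-collect mx [] [] =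
  [] , [] , [] , theorem mx (mp (J1 ⊥' ⊥') (nec (⊢-taut λ _ → holds refl))) ,
  ⊢-taut λ _ → holds refl
boxSet-collect mx (_ ∷ S') ((A , Sₐ , Sₐ⊆S , A▷ , refl) ∷ ps)
  with boxSet-collect mx S' ps
... | As , Sᵤ , Sᵤ⊆S , As▷ , ⋁¬S'⇒◇ =
  A ∷ As , Sₐ ++ Sᵤ , ++⁺ Sₐ⊆S Sᵤ⊆S ,
  ▷-join mx (▷-weakenʳ mx A▷  (⊢-taut λ _ → ⇒-intro (⋁¬-++ˡ Sₐ Sᵤ)))
            (▷-weakenʳ mx As▷ (⊢-taut λ _ → ⇒-intro (⋁¬-++ʳ Sₐ Sᵤ))) ,
  ⊢-from (_ ∷ _ ∷ _ ∷ [])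
    (◇-mono {A} {A ∨' ⋁ As} (⊢-taut λ _ → ⇒-intro ∨-introˡ) ∷ ⋁¬S'⇒◇ ∷
     ◇-mono {⋁ As} {A ∨' ⋁ As} (⊢-taut λ _ → ⇒-intro ∨-introʳ) ∷ [])
    λ { v (◇A⇒ ∷ rest⇒ ∷ ◇As⇒ ∷ []) → ⇒-intro λ h →
          ∨-elim h (⇒-elim ◇A⇒) (λ r → ⇒-elim ◇As⇒ (⇒-elim rest⇒ r)) }

mainTheorem15 : (w x u S : FmSet) → MCS w → MCS x → MCS u →
    w ≺ x → x ≺[ S ] u → w ≺[ boxSet x S ] u
mainTheorem15 w x u S mw mx _ w≺x x≺u S' S'⊆ A A▷S'
  with boxSet-collect mx S' S'⊆
... | As , Sᵤ , Sᵤ⊆S , As▷Sᵤ , ⋁¬S'⇒◇ =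
  let A▷◇As : w (A ▷ ◇ (⋁ As))
      A▷◇As = ▷-weakenʳ mw A▷S' ⋁¬S'⇒◇
      □A▷As : w (□ (A ▷ ⋁ As))
      □A▷As = closed-sem mw (_ ∷ _ ∷ []) (A▷◇As ∷ theorem mw (P0 A (⋁ As)) ∷ [])
                λ { v (p ∷ p0 ∷ []) → ⇒-elim p0 p }
      A▷As : x (A ▷ ⋁ As)
      A▷As = closed-sem mx (_ ∷ []) (proj₁ (w≺x [] [] (~ (A ▷ ⋁ As)) □A▷As) ∷ [])
                λ { v (p ∷ []) → ¬¬-elim p }
  in x≺u Sᵤ Sᵤ⊆S A (▷-trans mx A▷As As▷Sᵤ)
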